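{- Let $n\geq 7$. Among all complete bipartite graphs on $n$ vertices, the maximum value of $\sigma_t$ is attained by either $K_{\lfloor\frac{n}{4}(2-\sqrt{2})\rfloor, \lceil\frac{n}{4}(2+\sqrt{2})\rceil}$ or $K_{\lceil\frac{n}{4}(2-\sqrt{2})\rceil, \lfloor\frac{n}{4}(2+\sqrt{2})\rfloor}$.
   Context: For a finite simple graph $G$ with $d(v)$ the degree of $v$, $\sigma_{t}(G)=\sum_{\{u,v\}\subseteq V(G)}(d(u)-d(v))^{2}$, summing over all unordered pairs of distinct vertices. $K_{a,b}$ denotes the complete bipartite graph with parts of sizes $a$ and $b$. -}

module Defs where

open import Data.Bool using (Bool; true; false; if_then_else_; _xor_)
open import Data.Nat using (ℕ; zero; suc; _+_; _*_; _∸_; _≤_; _<_; _<ᵇ_; ∣_-_∣)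
open import Data.Fin using (Fin; toℕ)
open import Data.List using (List; map; allFin)
open import Data.Nat.ListAction using (sum)
open import Data.Product using (_×_)
open import Data.Sum using (_⊎_)
open import Relation.Binary.PropositionalEquality using (_≡_)

Graph : ℕ → Set
Graph n = Fin n → Fin n → Bool

deg : ∀ {n} → Graph n → Fin n → ℕ
deg {n} G v = sum (map (λ u → if G v u then 1 else 0) (allFin n))

σt : ∀ {n} → Graph n → ℕ
σt {n} G = sum (map (λ u → sum (map (λ v →
             if toℕ u <ᵇ toℕ v
             then ∣ deg G u - deg G v ∣ * ∣ deg G u - deg G v ∣
             else 0) (allFin n))) (allFin n))

K : (a b : ℕ) → Graph (a + b)
K a b i j = (toℕ i <ᵇ a) xor (toℕ j <ᵇ a)

-- Comparisons of a natural u with n√2, by squaring (both sides nonnegative).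
_≤n√2[_] : ℕ → ℕ → Set
u ≤n√2[ n ] = u * u ≤ 2 * (n * n)

_<n√2[_] : ℕ → ℕ → Set
u <n√2[ n ] = u * u < 2 * (n * n)

n√2[_]≤_ : ℕ → ℕ → Set
n√2[ n ]≤ u = 2 * (n * n) ≤ u * u

n√2[_]<_ : ℕ → ℕ → Set
n√2[ n ]< u = 2 * (n * n) < u * u

-- x = n(2 - √2)/4 ,  y = n(2 + √2)/4.

-- f = ⌊x⌋ :  4f ≤ 2n - n√2  and  2n - n√2 < 4(f+1)
IsFloorX : ℕ → ℕ → Set
IsFloorX n f = (4 * f ≤ 2 * n × n√2[ n ]≤ (2 * n ∸ 4 * f))
             × (2 * n < 4 * suc f ⊎ (2 * n ∸ 4 * suc f) <n√2[ n ])

-- c = ⌈x⌉ :  2n - n√2 ≤ 4c  and  4c < 2n - n√2 + 4  (i.e. c - 1 < x)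
IsCeilX : ℕ → ℕ → Set
IsCeilX n c = (2 * n ≤ 4 * c ⊎ (2 * n ∸ 4 * c) ≤n√2[ n ])
            × (4 * c < 2 * n + 4 × n√2[ n ]< (2 * n + 4 ∸ 4 * c))

-- f = ⌊y⌋ :  4f ≤ 2n + n√2  and  2n + n√2 < 4(f+1)
IsFloorY : ℕ → ℕ → Set
IsFloorY n f = (4 * f ≤ 2 * n ⊎ (4 * f ∸ 2 * n) ≤n√2[ n ])
             × (2 * n < 4 * suc f × n√2[ n ]< (4 * suc f ∸ 2 * n))

-- c = ⌈y⌉ :  2n + n√2 ≤ 4c  and  4c < 2n + n√2 + 4
IsCeilY : ℕ → ℕ → Set
IsCeilY n c = (2 * n ≤ 4 * c × n√2[ n ]≤ (4 * c ∸ 2 * n))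
            × (4 * c < 2 * n + 4 ⊎ (4 * c ∸ (2 * n + 4)) <n√2[ n ])

MaxAmongKab : ℕ → ℕ → ℕ → Set
MaxAmongKab n a b = (a + b ≡ n) × (1 ≤ a) × (1 ≤ b)
  × (∀ a′ b′ → a′ + b′ ≡ n → 1 ≤ a′ → 1 ≤ b′ → σt (K a′ b′) ≤ σt (K a b))

module Submission where

-- For a + b = n, σt (K a b) = p e with p = a b and e = (a - b)², and 4 p + e = n².
-- So along the splits σt is the parabola p (n² - 4 p), with vertex at 4 p = e,
-- that is at a = x; and p = a (n - a) increases with a while a ≤ n / 2. Hence
-- every split with a ≤ ⌊x⌋ is dominated by K ⌊x⌋ ⌈y⌉, and every split with
-- ⌈x⌉ ≤ a ≤ n / 2 by K ⌈x⌉ ⌊y⌋.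

open import Defs
open import Data.Bool using (true; false; if_then_else_; _xor_)
open import Data.Bool.Properties using (if-eta; T-≡; ¬-not)
open import Data.Nat using (ℕ; zero; suc; _+_; _*_; _∸_; _≤_; _<_; _<ᵇ_; ∣_-_∣; z≤n; s≤s; s≤s⁻¹; z<s; s<s)
open import Data.Nat.Properties
open import Data.Nat.ListAction using (sum)
open import Data.Nat.ListAction.Properties using (sum-++)
open import Data.Nat.Tactic.RingSolver using (solve-∀)
open import Data.Fin using (toℕ)
open import Data.List using (_∷_; _++_; map; allFin; tabulate; applyUpTo)
open import Data.List.Properties using (map-tabulate)
open import Data.Product using (_,_; proj₁; proj₂)
open import Data.Sum using (_⊎_; inj₁; inj₂; [_,_]′)
open import Function using (_∘_; id)
open import Function.Bundles using (Equivalence)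
open import Relation.Nullary using (¬_; contradiction)
open import Relation.Binary.PropositionalEquality using (_≡_; refl; sym; trans; cong; cong₂; subst; subst₂; module ≡-Reasoning)

tabulate-∘toℕ : ∀ {A : Set} n (g : ℕ → A) → tabulate {n = n} (g ∘ toℕ) ≡ applyUpTo g n
tabulate-∘toℕ zero    g = refl
tabulate-∘toℕ (suc n) g = cong (g 0 ∷_) (tabulate-∘toℕ n (g ∘ suc))

applyUpTo-+ : ∀ {A : Set} m n (g : ℕ → A) →
              applyUpTo g (m + n) ≡ applyUpTo g m ++ applyUpTo (g ∘ (m +_)) n
applyUpTo-+ zero    n g = refl
applyUpTo-+ (suc m) n g = cong (g 0 ∷_) (applyUpTo-+ m n (g ∘ suc))

sum-applyUpTo-const : ∀ n {g : ℕ → ℕ} {c} → (∀ k → k < n → g k ≡ c) → sum (applyUpTo g n) ≡ n * c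
sum-applyUpTo-const zero    _   = refl
sum-applyUpTo-const (suc n) g≡c =
  cong₂ _+_ (g≡c 0 z<s) (sum-applyUpTo-const n (λ k k<n → g≡c (suc k) (s<s k<n)))

sum-allFin-blocks : ∀ a b {g : ℕ → ℕ} {p q} →
                    (∀ k → k < a → g k ≡ p) → (∀ i → i < b → g (a + i) ≡ q) →
                    sum (map (g ∘ toℕ) (allFin (a + b))) ≡ a * p + b * q
sum-allFin-blocks a b {g} {p} {q} first second = begin
  sum (map (g ∘ toℕ) (allFin (a + b)))
    ≡⟨ cong sum (map-tabulate {n = a + b} id (g ∘ toℕ)) ⟩
  sum (tabulate {n = a + b} (g ∘ toℕ))
    ≡⟨ cong sum (tabulate-∘toℕ (a + b) g) ⟩
  sum (applyUpTo g (a + b))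
    ≡⟨ cong sum (applyUpTo-+ a b g) ⟩
  sum (applyUpTo g a ++ applyUpTo (g ∘ (a +_)) b)
    ≡⟨ sum-++ (applyUpTo g a) _ ⟩
  sum (applyUpTo g a) + sum (applyUpTo (g ∘ (a +_)) b)
    ≡⟨ cong₂ _+_ (sum-applyUpTo-const a first) (sum-applyUpTo-const b second) ⟩
  a * p + b * q
    ∎
  where open ≡-Reasoning

<⇒<ᵇ≡true : ∀ {m n} → m < n → (m <ᵇ n) ≡ true
<⇒<ᵇ≡true m<n = Equivalence.to T-≡ (<⇒<ᵇ m<n)

≮⇒<ᵇ≡false : ∀ {m n} → ¬ m < n → (m <ᵇ n) ≡ false
≮⇒<ᵇ≡false {m} {n} m≮n = ¬-not (m≮n ∘ <ᵇ⇒< m n ∘ Equivalence.from T-≡)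

∣_-_∣² : ℕ → ℕ → ℕ
∣ m - n ∣² = ∣ m - n ∣ * ∣ m - n ∣

∣n-n∣²≡0 : ∀ n → ∣ n - n ∣² ≡ 0
∣n-n∣²≡0 n = cong (λ d → d * d) (m≡n⇒∣m-n∣≡0 {n} refl)

∣-∣²-comm : ∀ m n → ∣ m - n ∣² ≡ ∣ n - m ∣²
∣-∣²-comm m n = cong (λ d → d * d) (∣-∣-comm m n)

σK : ℕ → ℕ → ℕ
σK a b = a * b * ∣ a - b ∣²

-- At k = toℕ v, degK a b k is definitionally deg (K a b) v, and σt-K-row a b k
-- the inner sum of σt (K a b) at v.
degK : ℕ → ℕ → ℕ → ℕ
degK a b k = sum (map (λ w → if (k <ᵇ a) xor (toℕ w <ᵇ a) then 1 else 0) (allFin (a + b)))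

degK-first : ∀ {a b k} → k < a → degK a b k ≡ b
degK-first {a} {b} {k} k<a =
  trans (sum-allFin-blocks a b same other) (cong₂ _+_ (*-zeroʳ a) (*-identityʳ b))
  where
  same : ∀ l → l < a → (if (k <ᵇ a) xor (l <ᵇ a) then 1 else 0) ≡ 0
  same l l<a rewrite <⇒<ᵇ≡true k<a | <⇒<ᵇ≡true l<a = refl
  other : ∀ i → i < b → (if (k <ᵇ a) xor (a + i <ᵇ a) then 1 else 0) ≡ 1
  other i _ rewrite <⇒<ᵇ≡true k<a | ≮⇒<ᵇ≡false (m+n≮m a i) = refl

degK-second : ∀ a b i → degK a b (a + i) ≡ a
degK-second a b i = trans (sum-allFin-blocks a b other same)
                          (trans (cong₂ _+_ (*-identityʳ a) (*-zeroʳ b)) (+-identityʳ a))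
  where
  other : ∀ l → l < a → (if (a + i <ᵇ a) xor (l <ᵇ a) then 1 else 0) ≡ 1
  other l l<a rewrite ≮⇒<ᵇ≡false (m+n≮m a i) | <⇒<ᵇ≡true l<a = refl
  same : ∀ j → j < b → (if (a + i <ᵇ a) xor (a + j <ᵇ a) then 1 else 0) ≡ 0
  same j _ rewrite ≮⇒<ᵇ≡false (m+n≮m a i) | ≮⇒<ᵇ≡false (m+n≮m a j) = refl

σt-K-row : ℕ → ℕ → ℕ → ℕ
σt-K-row a b k =
  sum (map (λ v → if k <ᵇ toℕ v then ∣ degK a b k - degK a b (toℕ v) ∣² else 0) (allFin (a + b)))

σt-K-row-first : ∀ {a b k} → k < a → σt-K-row a b k ≡ b * ∣ b - a ∣²
σt-K-row-first {a} {b} {k} k<a =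
  trans (sum-allFin-blocks a b same other) (cong (_+ b * ∣ b - a ∣²) (*-zeroʳ a))
  where
  same : ∀ l → l < a → (if k <ᵇ l then ∣ degK a b k - degK a b l ∣² else 0) ≡ 0
  same l l<a rewrite degK-first {b = b} k<a | degK-first {b = b} l<a | ∣n-n∣²≡0 b = if-eta (k <ᵇ l)
  other : ∀ j → j < b → (if k <ᵇ a + j then ∣ degK a b k - degK a b (a + j) ∣² else 0) ≡ ∣ b - a ∣²
  other j _ rewrite degK-first {b = b} k<a | degK-second a b j
                  | <⇒<ᵇ≡true (<-≤-trans k<a (m≤m+n a j)) = refl

σt-K-row-second : ∀ a b i → σt-K-row a b (a + i) ≡ 0
σt-K-row-second a b i =
  trans (sum-allFin-blocks a b earlier same) (cong₂ _+_ (*-zeroʳ a) (*-zeroʳ b))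
  where
  earlier : ∀ l → l < a → (if a + i <ᵇ l then ∣ degK a b (a + i) - degK a b l ∣² else 0) ≡ 0
  earlier l l<a rewrite ≮⇒<ᵇ≡false (≤⇒≯ (≤-trans (<⇒≤ l<a) (m≤m+n a i))) = refl
  same : ∀ j → j < b → (if a + i <ᵇ a + j then ∣ degK a b (a + i) - degK a b (a + j) ∣² else 0) ≡ 0
  same j _ rewrite degK-second a b i | degK-second a b j | ∣n-n∣²≡0 a = if-eta (a + i <ᵇ a + j)

σt-K : ∀ a b → σt (K a b) ≡ σK a b
σt-K a b = begin
  σt (K a b)
    ≡⟨ sum-allFin-blocks a b (λ _ → σt-K-row-first) (λ i _ → σt-K-row-second a b i) ⟩
  a * (b * ∣ b - a ∣²) + b * 0        ≡⟨ cong (a * (b * ∣ b - a ∣²) +_) (*-zeroʳ b) ⟩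
  a * (b * ∣ b - a ∣²) + 0            ≡⟨ +-identityʳ _ ⟩
  a * (b * ∣ b - a ∣²)                ≡⟨ sym (*-assoc a b _) ⟩
  a * b * ∣ b - a ∣²                  ≡⟨ cong (a * b *_) (∣-∣²-comm b a) ⟩
  σK a b                              ∎
  where open ≡-Reasoning

σK-comm : ∀ a b → σK a b ≡ σK b a
σK-comm a b = cong₂ _*_ (*-comm a b) (∣-∣²-comm a b)

4*[m*n]+∣m-n∣²≡[m+n]² : ∀ m n → 4 * (m * n) + ∣ m - n ∣² ≡ (m + n) * (m + n)
4*[m*n]+∣m-n∣²≡[m+n]² m n = [ ordered , flipped ]′ (≤-total m n)
  where
  open ≡-Reasoning
  ordered : ∀ {m n} → m ≤ n → 4 * (m * n) + ∣ m - n ∣² ≡ (m + n) * (m + n)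
  ordered {m} m≤n with m≤n⇒∃[o]m+o≡n m≤n
  ... | d , refl rewrite ∣m-m+n∣≡n m d = expand m d
    where
    expand : ∀ m d → 4 * (m * (m + d)) + d * d ≡ (m + (m + d)) * (m + (m + d))
    expand = solve-∀
  flipped : n ≤ m → 4 * (m * n) + ∣ m - n ∣² ≡ (m + n) * (m + n)
  flipped n≤m = begin
    4 * (m * n) + ∣ m - n ∣²  ≡⟨ cong₂ (λ x y → 4 * x + y) (*-comm m n) (∣-∣²-comm m n) ⟩
    4 * (n * m) + ∣ n - m ∣²  ≡⟨ ordered n≤m ⟩
    (n + m) * (n + m)         ≡⟨ cong (λ s → s * s) (+-comm n m) ⟩
    (m + n) * (m + n)         ∎

a+b≡c+d⇒4*[a*b]+∣a-b∣²≡4*[c*d]+∣c-d∣² : ∀ {a b c d} → a + b ≡ c + d →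
  4 * (a * b) + ∣ a - b ∣² ≡ 4 * (c * d) + ∣ c - d ∣²
a+b≡c+d⇒4*[a*b]+∣a-b∣²≡4*[c*d]+∣c-d∣² {a} {b} {c} {d} a+b≡c+d = begin
  4 * (a * b) + ∣ a - b ∣²   ≡⟨ 4*[m*n]+∣m-n∣²≡[m+n]² a b ⟩
  (a + b) * (a + b)          ≡⟨ cong (λ s → s * s) a+b≡c+d ⟩
  (c + d) * (c + d)          ≡⟨ 4*[m*n]+∣m-n∣²≡[m+n]² c d ⟨
  4 * (c * d) + ∣ c - d ∣²   ∎
  where open ≡-Reasoning

*-mono-fixed-sum : ∀ {a b c d} → a ≤ c → c ≤ d → a + b ≡ c + d → a * b ≤ c * d
*-mono-fixed-sum {a} {b} {c} {d} a≤c c≤d a+b≡c+d with m≤n⇒∃[o]m+o≡n a≤c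
... | t , refl = begin
  a * b           ≡⟨ cong (a *_) b≡d+t ⟩
  a * (d + t)     ≡⟨ *-distribˡ-+ a d t ⟩
  a * d + a * t   ≤⟨ +-monoʳ-≤ (a * d) (*-monoˡ-≤ t (≤-trans a≤c c≤d)) ⟩
  a * d + d * t   ≡⟨ collect a d t ⟩
  (a + t) * d     ∎
  where
  open ≤-Reasoning
  regroup : ∀ a t d → a + t + d ≡ a + (d + t)
  regroup = solve-∀
  b≡d+t : b ≡ d + t
  b≡d+t = +-cancelˡ-≡ a b (d + t) (trans a+b≡c+d (regroup a t d))
  collect : ∀ a d t → a * d + d * t ≡ (a + t) * d
  collect = solve-∀

-- On the line 4 * p + e = N the product p * e is the parabola p (N - 4 p),
-- which increases up to its vertex, where 4 * p = e, and decreases after it.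
*-mono-below-vertex : ∀ {p e q g} → 4 * p + e ≡ 4 * q + g → p ≤ q → 4 * q ≤ g → p * e ≤ q * g
*-mono-below-vertex {p} {e} {q} {g} line p≤q 4q≤g with m≤n⇒∃[o]m+o≡n p≤q
... | s , refl = begin
  p * e                 ≡⟨ cong (p *_) e≡g+4s ⟩
  p * (g + 4 * s)       ≡⟨ expand p g s ⟩
  p * g + s * (4 * p)   ≤⟨ +-monoʳ-≤ (p * g) (*-monoʳ-≤ s 4p≤g) ⟩
  p * g + s * g         ≡⟨ collect p g s ⟩
  (p + s) * g           ∎
  where
  open ≤-Reasoning
  regroup : ∀ p s g → 4 * (p + s) + g ≡ 4 * p + (g + 4 * s)
  regroup = solve-∀
  e≡g+4s : e ≡ g + 4 * s
  e≡g+4s = +-cancelˡ-≡ (4 * p) e (g + 4 * s) (trans line (regroup p s g))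
  4p≤g : 4 * p ≤ g
  4p≤g = ≤-trans (*-monoʳ-≤ 4 (m≤m+n p s)) 4q≤g
  expand : ∀ p g s → p * (g + 4 * s) ≡ p * g + s * (4 * p)
  expand = solve-∀
  collect : ∀ p g s → p * g + s * g ≡ (p + s) * g
  collect = solve-∀

*-antimono-above-vertex : ∀ {p e q g} → 4 * p + e ≡ 4 * q + g → q ≤ p → g ≤ 4 * q → p * e ≤ q * g
*-antimono-above-vertex {p} {e} {q} {g} line q≤p g≤4q with m≤n⇒∃[o]m+o≡n q≤p
... | s , refl = begin
  (q + s) * e           ≡⟨ expand q s e ⟩
  q * e + s * e         ≤⟨ +-monoʳ-≤ (q * e) (*-monoʳ-≤ s e≤4q) ⟩
  q * e + s * (4 * q)   ≡⟨ collect q e s ⟩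
  q * (e + 4 * s)       ≡⟨ cong (q *_) g≡e+4s ⟨
  q * g                 ∎
  where
  open ≤-Reasoning
  regroup : ∀ q s e → 4 * (q + s) + e ≡ 4 * q + (e + 4 * s)
  regroup = solve-∀
  g≡e+4s : g ≡ e + 4 * s
  g≡e+4s = +-cancelˡ-≡ (4 * q) g (e + 4 * s) (trans (sym line) (regroup q s e))
  e≤4q : e ≤ 4 * q
  e≤4q = ≤-trans (m≤m+n e (4 * s)) (subst (_≤ 4 * q) g≡e+4s g≤4q)
  expand : ∀ q s e → (q + s) * e ≡ q * e + s * e
  expand = solve-∀
  collect : ∀ q e s → q * e + s * (4 * q) ≡ q * (e + 4 * s)
  collect = solve-∀

σK-≤-below-vertex : ∀ {a b a₀ b₀} → a ≤ a₀ → a₀ ≤ b₀ → a + b ≡ a₀ + b₀ →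
                    4 * (a₀ * b₀) ≤ ∣ a₀ - b₀ ∣² → σK a b ≤ σK a₀ b₀
σK-≤-below-vertex {a} {b} {a₀} {b₀} a≤a₀ a₀≤b₀ a+b≡a₀+b₀ =
  *-mono-below-vertex (a+b≡c+d⇒4*[a*b]+∣a-b∣²≡4*[c*d]+∣c-d∣² {a} {b} {a₀} {b₀} a+b≡a₀+b₀)
                      (*-mono-fixed-sum a≤a₀ a₀≤b₀ a+b≡a₀+b₀)

σK-≤-above-vertex : ∀ {a b a₀ b₀} → a₀ ≤ a → a ≤ b → a + b ≡ a₀ + b₀ →
                    ∣ a₀ - b₀ ∣² ≤ 4 * (a₀ * b₀) → σK a b ≤ σK a₀ b₀
σK-≤-above-vertex {a} {b} {a₀} {b₀} a₀≤a a≤b a+b≡a₀+b₀ =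
  *-antimono-above-vertex (a+b≡c+d⇒4*[a*b]+∣a-b∣²≡4*[c*d]+∣c-d∣² {a} {b} {a₀} {b₀} a+b≡a₀+b₀)
                          (*-mono-fixed-sum a₀≤a a≤b (sym a+b≡a₀+b₀))

a≤b⇒4*a≤2*n : ∀ {n a b} → a + b ≡ n → a ≤ b → 4 * a ≤ 2 * n
a≤b⇒4*a≤2*n {a = a} {b} refl a≤b =
  subst₂ _≤_ (double a) (sym (*-distribˡ-+ 2 a b)) (+-monoʳ-≤ (2 * a) (*-monoʳ-≤ 2 a≤b))
  where
  double : ∀ a → 2 * a + 2 * a ≡ 4 * a
  double = solve-∀

4*a≤2*n⇒a≤b : ∀ {n a b} → a + b ≡ n → 4 * a ≤ 2 * n → a ≤ b
4*a≤2*n⇒a≤b {a = a} {b} refl 4a≤2n =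
  *-cancelˡ-≤ 2 (+-cancelˡ-≤ (2 * a) _ _ (subst₂ _≤_ (sym (double a)) (*-distribˡ-+ 2 a b) 4a≤2n))
  where
  double : ∀ a → 2 * a + 2 * a ≡ 4 * a
  double = solve-∀

[2*[a+b]∸4*a]²≡2*[∣a-b∣²+∣a-b∣²] : ∀ {a b} → a ≤ b →
  (2 * (a + b) ∸ 4 * a) * (2 * (a + b) ∸ 4 * a) ≡ 2 * (∣ a - b ∣² + ∣ a - b ∣²)
[2*[a+b]∸4*a]²≡2*[∣a-b∣²+∣a-b∣²] {a} a≤b with m≤n⇒∃[o]m+o≡n a≤b
... | d , refl = begin
  (2 * (a + (a + d)) ∸ 4 * a) * (2 * (a + (a + d)) ∸ 4 * a)
    ≡⟨ cong (λ x → (x ∸ 4 * a) * (x ∸ 4 * a)) (regroup a d) ⟩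
  (4 * a + 2 * d ∸ 4 * a) * (4 * a + 2 * d ∸ 4 * a)
    ≡⟨ cong (λ x → x * x) (m+n∸m≡n (4 * a) (2 * d)) ⟩
  2 * d * (2 * d)                              ≡⟨ double d ⟩
  2 * (d * d + d * d)                          ≡⟨ cong (λ x → 2 * (x * x + x * x)) (∣m-m+n∣≡n a d) ⟨
  2 * (∣ a - (a + d) ∣² + ∣ a - (a + d) ∣²)    ∎
  where
  open ≡-Reasoning
  regroup : ∀ a d → 2 * (a + (a + d)) ≡ 4 * a + 2 * d
  regroup = solve-∀
  double : ∀ d → 2 * d * (2 * d) ≡ 2 * (d * d + d * d)
  double = solve-∀

left-of-x⇒4*[a*b]≤∣a-b∣² : ∀ {n a b} → a + b ≡ n → a ≤ b → n√2[ n ]≤ (2 * n ∸ 4 * a) →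
                            4 * (a * b) ≤ ∣ a - b ∣²
left-of-x⇒4*[a*b]≤∣a-b∣² {a = a} {b} refl a≤b left =
  +-cancelʳ-≤ ∣ a - b ∣² (4 * (a * b)) ∣ a - b ∣² (*-cancelˡ-≤ 2 (begin
    2 * (4 * (a * b) + ∣ a - b ∣²)   ≡⟨ cong (2 *_) (4*[m*n]+∣m-n∣²≡[m+n]² a b) ⟩
    2 * ((a + b) * (a + b))          ≤⟨ left ⟩
    (2 * (a + b) ∸ 4 * a) * (2 * (a + b) ∸ 4 * a)  ≡⟨ [2*[a+b]∸4*a]²≡2*[∣a-b∣²+∣a-b∣²] a≤b ⟩
    2 * (∣ a - b ∣² + ∣ a - b ∣²)    ∎))
  where open ≤-Reasoning

right-of-x⇒∣a-b∣²≤4*[a*b] : ∀ {n a b} → a + b ≡ n → a ≤ b → (2 * n ∸ 4 * a) ≤n√2[ n ] →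
                             ∣ a - b ∣² ≤ 4 * (a * b)
right-of-x⇒∣a-b∣²≤4*[a*b] {a = a} {b} refl a≤b right =
  +-cancelʳ-≤ ∣ a - b ∣² ∣ a - b ∣² (4 * (a * b)) (*-cancelˡ-≤ 2 (begin
    2 * (∣ a - b ∣² + ∣ a - b ∣²)    ≡⟨ [2*[a+b]∸4*a]²≡2*[∣a-b∣²+∣a-b∣²] a≤b ⟨
    (2 * (a + b) ∸ 4 * a) * (2 * (a + b) ∸ 4 * a)  ≤⟨ right ⟩
    2 * ((a + b) * (a + b))          ≡⟨ cong (2 *_) (4*[m*n]+∣m-n∣²≡[m+n]² a b) ⟨
    2 * (4 * (a * b) + ∣ a - b ∣²)   ∎))
  where open ≤-Reasoning

∸-<n√2 : ∀ {n a b} → 1 ≤ n → a < b ⊎ (a ∸ b) <n√2[ n ] → (a ∸ b) <n√2[ n ]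
∸-<n√2 (s≤s z≤n) (inj₁ a<b) rewrite m≤n⇒m∸n≡0 (<⇒≤ a<b) = z<s
∸-<n√2 _         (inj₂ below) = below

∸-≤n√2 : ∀ {n a b} → a ≤ b ⊎ (a ∸ b) ≤n√2[ n ] → (a ∸ b) ≤n√2[ n ]
∸-≤n√2 (inj₁ a≤b) rewrite m≤n⇒m∸n≡0 a≤b = z≤n
∸-≤n√2 (inj₂ below) = below

[m∸4]²<n²⇒m<4+n : ∀ {m n} → (m ∸ 4) * (m ∸ 4) < n * n → m < 4 + n
[m∸4]²<n²⇒m<4+n {m} {n} lt = ≤-<-trans (m≤n+m∸n m 4) (+-monoʳ-< 4 m∸4<n)
  where
  m∸4<n : m ∸ 4 < n
  m∸4<n = ≰⇒> (λ n≤m∸4 → <⇒≱ lt (*-mono-≤ n≤m∸4 n≤m∸4))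

4*m+u≡4*n+w⇒m≡n : ∀ m n {u w} → u < 4 + w → w < 4 + u → 4 * m + u ≡ 4 * n + w → m ≡ n
4*m+u≡4*n+w⇒m≡n zero    zero    _     _     _  = refl
4*m+u≡4*n+w⇒m≡n zero    (suc n) {w = w} u<4+w _ eq =
  contradiction (subst (4 + w ≤_) (sym eq) (+-monoˡ-≤ w (*-monoʳ-≤ 4 (s≤s z≤n)))) (<⇒≱ u<4+w)
4*m+u≡4*n+w⇒m≡n (suc m) zero    {u} _ w<4+u eq =
  contradiction (subst (4 + u ≤_) eq (+-monoˡ-≤ u (*-monoʳ-≤ 4 (s≤s z≤n)))) (<⇒≱ w<4+u)
4*m+u≡4*n+w⇒m≡n (suc m) (suc n) {u} {w} u<4+w w<4+u eq =
  cong suc (4*m+u≡4*n+w⇒m≡n m n u<4+w w<4+u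
    (+-cancelˡ-≡ 4 _ _ (trans (sym (peel m u)) (trans eq (peel n w)))))
  where
  peel : ∀ k v → 4 * suc k + v ≡ 4 + (4 * k + v)
  peel = solve-∀

-- u = 2n - 4f and w = 4c - 2n both lie in [n√2, n√2 + 4), and 4 (f + c) + u = 4 n + w.
floorX+ceilY≡n : ∀ {n f c} → 1 ≤ n → IsFloorX n f → IsCeilY n c → f + c ≡ n
floorX+ceilY≡n {n} {f} {c} 1≤n ((4f≤2n , u-big) , u-small) ((2n≤4c , w-big) , w-small) =
  4*m+u≡4*n+w⇒m≡n (f + c) n u<4+w w<4+u balance
  where
  u = 2 * n ∸ 4 * f
  w = 4 * c ∸ 2 * n
  u∸4 : u ∸ 4 ≡ 2 * n ∸ 4 * suc f
  u∸4 = trans (∸-+-assoc (2 * n) (4 * f) 4)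
              (cong (2 * n ∸_) (trans (+-comm (4 * f) 4) (sym (*-suc 4 f))))
  u<4+w : u < 4 + w
  u<4+w = [m∸4]²<n²⇒m<4+n
            (<-≤-trans (subst (λ v → v <n√2[ n ]) (sym u∸4) (∸-<n√2 1≤n u-small)) w-big)
  w<4+u : w < 4 + u
  w<4+u = [m∸4]²<n²⇒m<4+n
            (<-≤-trans (subst (λ v → v <n√2[ n ]) (sym (∸-+-assoc (4 * c) (2 * n) 4))
                              (∸-<n√2 1≤n w-small)) u-big)
  regroup : ∀ f c u → 4 * (f + c) + u ≡ (u + 4 * f) + 4 * c
  regroup = solve-∀
  collect : ∀ n w → 2 * n + (w + 2 * n) ≡ 4 * n + w
  collect = solve-∀
  balance : 4 * (f + c) + u ≡ 4 * n + w
  balance = begin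
    4 * (f + c) + u      ≡⟨ regroup f c u ⟩
    (u + 4 * f) + 4 * c  ≡⟨ cong (_+ 4 * c) (m∸n+n≡m 4f≤2n) ⟩
    2 * n + 4 * c        ≡⟨ cong (2 * n +_) (m∸n+n≡m 2n≤4c) ⟨
    2 * n + (w + 2 * n)  ≡⟨ collect n w ⟩
    4 * n + w            ∎
    where open ≡-Reasoning

ceilX+floorY≡n : ∀ {n c f} → 1 ≤ n → IsCeilX n c → IsFloorY n f → c + f ≡ n
ceilX+floorY≡n {n} {c} {f} 1≤n (u-small , 4c<2n+4 , u-big) (w-small , 2n<4[f+1] , w-big) =
  4*m+u≡4*n+w⇒m≡n (c + f) n u<4+w w<4+u balance
  where
  u = 2 * n + 4 ∸ 4 * c
  w = 4 * suc f ∸ 2 * n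
  u∸4 : u ∸ 4 ≡ 2 * n ∸ 4 * c
  u∸4 = begin
    (2 * n + 4 ∸ 4 * c) ∸ 4   ≡⟨ ∸-+-assoc (2 * n + 4) (4 * c) 4 ⟩
    2 * n + 4 ∸ (4 * c + 4)   ≡⟨ cong₂ _∸_ (+-comm (2 * n) 4) (+-comm (4 * c) 4) ⟩
    4 + 2 * n ∸ (4 + 4 * c)   ≡⟨ [m+n]∸[m+o]≡n∸o 4 (2 * n) (4 * c) ⟩
    2 * n ∸ 4 * c             ∎
    where open ≡-Reasoning
  w∸4 : w ∸ 4 ≡ 4 * f ∸ 2 * n
  w∸4 = begin
    (4 * suc f ∸ 2 * n) ∸ 4   ≡⟨ ∸-+-assoc (4 * suc f) (2 * n) 4 ⟩
    4 * suc f ∸ (2 * n + 4)   ≡⟨ cong₂ _∸_ (*-suc 4 f) (+-comm (2 * n) 4) ⟩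
    4 + 4 * f ∸ (4 + 2 * n)   ≡⟨ [m+n]∸[m+o]≡n∸o 4 (4 * f) (2 * n) ⟩
    4 * f ∸ 2 * n             ∎
    where open ≡-Reasoning
  u<4+w : u < 4 + w
  u<4+w = [m∸4]²<n²⇒m<4+n
            (≤-<-trans (subst (λ v → v ≤n√2[ n ]) (sym u∸4) (∸-≤n√2 {n} u-small)) w-big)
  w<4+u : w < 4 + u
  w<4+u = [m∸4]²<n²⇒m<4+n
            (≤-<-trans (subst (λ v → v ≤n√2[ n ]) (sym w∸4) (∸-≤n√2 {n} w-small)) u-big)
  regroup : ∀ c f u → 4 * (c + f) + u ≡ (u + 4 * c) + 4 * f
  regroup = solve-∀
  collect₁ : ∀ n f → 2 * n + 4 + 4 * f ≡ 2 * n + 4 * suc f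
  collect₁ = solve-∀
  collect₂ : ∀ n w → 2 * n + (w + 2 * n) ≡ 4 * n + w
  collect₂ = solve-∀
  balance : 4 * (c + f) + u ≡ 4 * n + w
  balance = begin
    4 * (c + f) + u      ≡⟨ regroup c f u ⟩
    (u + 4 * c) + 4 * f  ≡⟨ cong (_+ 4 * f) (m∸n+n≡m (<⇒≤ 4c<2n+4)) ⟩
    2 * n + 4 + 4 * f    ≡⟨ collect₁ n f ⟩
    2 * n + 4 * suc f    ≡⟨ cong (2 * n +_) (m∸n+n≡m (<⇒≤ 2n<4[f+1])) ⟨
    2 * n + (w + 2 * n)  ≡⟨ collect₂ n w ⟩
    4 * n + w            ∎
    where open ≡-Reasoning

floorX-greatest : ∀ {n f a} → IsFloorX n f → 4 * a ≤ 2 * n → n√2[ n ]≤ (2 * n ∸ 4 * a) → a ≤ f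
floorX-greatest {n} {f} {a} (_ , above) 4a≤2n left = ≮⇒≥ f≮a
  where
  f≮a : ¬ f < a
  f≮a f<a = [ (λ 2n<4[f+1] → <⇒≱ 2n<4[f+1] (≤-trans 4[f+1]≤4a 4a≤2n))
            , (λ below → <⇒≱ below (≤-trans left (*-mono-≤ shrink shrink))) ]′ above
    where
    4[f+1]≤4a : 4 * suc f ≤ 4 * a
    4[f+1]≤4a = *-monoʳ-≤ 4 f<a
    shrink : 2 * n ∸ 4 * a ≤ 2 * n ∸ 4 * suc f
    shrink = ∸-monoʳ-≤ (2 * n) 4[f+1]≤4a

ceilX-least : ∀ {n c a} → IsCeilX n c → (2 * n ∸ 4 * a) ≤n√2[ n ] → c ≤ a
ceilX-least {n} {c} {a} (_ , _ , above) right = ≮⇒≥ a≮c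
  where
  a≮c : ¬ a < c
  a≮c a<c = <⇒≱ above (≤-trans (*-mono-≤ shrink shrink) right)
    where
    shrink : 2 * n + 4 ∸ 4 * c ≤ 2 * n ∸ 4 * a
    shrink = begin
      2 * n + 4 ∸ 4 * c        ≤⟨ ∸-monoʳ-≤ (2 * n + 4) (*-monoʳ-≤ 4 a<c) ⟩
      2 * n + 4 ∸ 4 * suc a    ≡⟨ cong₂ _∸_ (+-comm (2 * n) 4) (*-suc 4 a) ⟩
      4 + 2 * n ∸ (4 + 4 * a)  ≡⟨ [m+n]∸[m+o]≡n∸o 4 (2 * n) (4 * a) ⟩
      2 * n ∸ 4 * a            ∎
      where open ≤-Reasoning

ceilX-≤-half : ∀ {n c} → 3 ≤ n → IsCeilX n c → 4 * c ≤ 2 * n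
ceilX-≤-half {n} {c} 3≤n (_ , 4c<2n+4 , above) = +-cancelʳ-≤ 4 (4 * c) (2 * n) (begin
  4 * c + 4   ≤⟨ +-monoʳ-≤ (4 * c) 4≤u ⟩
  4 * c + u   ≡⟨ +-comm (4 * c) u ⟩
  u + 4 * c   ≡⟨ m∸n+n≡m (<⇒≤ 4c<2n+4) ⟩
  2 * n + 4   ∎)
  where
  open ≤-Reasoning
  u = 2 * n + 4 ∸ 4 * c
  u≤3⇒u²≤2n² : u ≤ 3 → u * u ≤ 2 * (n * n)
  u≤3⇒u²≤2n² u≤3 = begin
    u * u          ≤⟨ *-mono-≤ u≤3 u≤3 ⟩
    3 * 3          ≤⟨ m≤n*m (3 * 3) 2 ⟩
    2 * (3 * 3)    ≤⟨ *-monoʳ-≤ 2 (*-mono-≤ 3≤n 3≤n) ⟩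
    2 * (n * n)    ∎
  4≤u : 4 ≤ u
  4≤u = ≮⇒≥ (λ u<4 → <⇒≱ above (u≤3⇒u²≤2n² (s≤s⁻¹ u<4)))

n√2≤2n∸4 : ∀ {n} → 7 ≤ n → n√2[ n ]≤ (2 * n ∸ 4)
n√2≤2n∸4 7≤n with m≤n⇒∃[o]m+o≡n 7≤n
... | k , refl = begin
  2 * ((7 + k) * (7 + k))
    ≤⟨ m≤m+n _ (2 + 12 * k + 2 * (k * k)) ⟩
  2 * ((7 + k) * (7 + k)) + (2 + 12 * k + 2 * (k * k))
    ≡⟨ expand k ⟩
  (10 + 2 * k) * (10 + 2 * k)
    ≡⟨ cong (λ x → x * x) (m+n∸m≡n 4 (10 + 2 * k)) ⟨
  (4 + (10 + 2 * k) ∸ 4) * (4 + (10 + 2 * k) ∸ 4)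
    ≡⟨ cong (λ x → (x ∸ 4) * (x ∸ 4)) (regroup k) ⟨
  (2 * (7 + k) ∸ 4) * (2 * (7 + k) ∸ 4)
    ∎
  where
  open ≤-Reasoning
  expand : ∀ k → 2 * ((7 + k) * (7 + k)) + (2 + 12 * k + 2 * (k * k)) ≡ (10 + 2 * k) * (10 + 2 * k)
  expand = solve-∀
  regroup : ∀ k → 2 * (7 + k) ≡ 4 + (10 + 2 * k)
  regroup = solve-∀

-- This is where n ≥ 7 is needed: for n = 6 the floor of x is 0.
floorX-positive : ∀ {n f} → 7 ≤ n → IsFloorX n f → 1 ≤ f
floorX-positive {f = zero}  7≤n (_ , inj₁ 2n<4) =
  contradiction (≤-trans (m≤m+n 4 10) (*-monoʳ-≤ 2 7≤n)) (<⇒≱ 2n<4)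
floorX-positive {f = zero}  7≤n (_ , inj₂ below) = contradiction (n√2≤2n∸4 7≤n) (<⇒≱ below)
floorX-positive {f = suc _} _   _ = s≤s z≤n

ceilX-positive : ∀ {n c} → 1 ≤ n → IsCeilX n c → 1 ≤ c
ceilX-positive {c = zero}  (s≤s z≤n) (inj₁ () , _)
ceilX-positive {n} {zero}  (s≤s z≤n) (inj₂ 4n²≤2n² , _) =
  contradiction 4n²≤2n² (<⇒≱ (subst (2 * (n * n) <_) (sym (double n)) (m<m+n (2 * (n * n)) z<s)))
  where
  double : ∀ n → 2 * n * (2 * n) ≡ 2 * (n * n) + 2 * (n * n)
  double = solve-∀
ceilX-positive {c = suc _} _ _ = s≤s z≤n

maxAmongKab-of-cover : ∀ {n a₁ b₁ a₂ b₂} →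
  a₁ + b₁ ≡ n → 1 ≤ a₁ → 1 ≤ b₁ → a₂ + b₂ ≡ n → 1 ≤ a₂ → 1 ≤ b₂ →
  (∀ a b → a + b ≡ n → σK a b ≤ σK a₁ b₁ ⊎ σK a b ≤ σK a₂ b₂) →
  MaxAmongKab n a₁ b₁ ⊎ MaxAmongKab n a₂ b₂
maxAmongKab-of-cover {n} {a₁} {b₁} {a₂} {b₂} split₁ 1≤a₁ 1≤b₁ split₂ 1≤a₂ 1≤b₂ cover =
  [ first-wins , second-wins ]′ (≤-total (σK a₂ b₂) (σK a₁ b₁))
  where
  maximal : ∀ {a₀ b₀} → (∀ {s} → s ≤ σK a₁ b₁ ⊎ s ≤ σK a₂ b₂ → s ≤ σK a₀ b₀) →
            ∀ a b → a + b ≡ n → 1 ≤ a → 1 ≤ b → σt (K a b) ≤ σt (K a₀ b₀)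
  maximal {a₀} {b₀} bound a b a+b≡n _ _ =
    subst₂ _≤_ (sym (σt-K a b)) (sym (σt-K a₀ b₀)) (bound (cover a b a+b≡n))
  first-wins : σK a₂ b₂ ≤ σK a₁ b₁ → MaxAmongKab n a₁ b₁ ⊎ MaxAmongKab n a₂ b₂
  first-wins σ₂≤σ₁ = inj₁ (split₁ , 1≤a₁ , 1≤b₁ ,
    maximal {a₁} {b₁} [ id , (λ σ≤σ₂ → ≤-trans σ≤σ₂ σ₂≤σ₁) ]′)
  second-wins : σK a₁ b₁ ≤ σK a₂ b₂ → MaxAmongKab n a₁ b₁ ⊎ MaxAmongKab n a₂ b₂
  second-wins σ₁≤σ₂ = inj₂ (split₂ , 1≤a₂ , 1≤b₂ ,
    maximal {a₂} {b₂} [ (λ σ≤σ₁ → ≤-trans σ≤σ₁ σ₁≤σ₂) , id ]′)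

module Candidates {n f₁ c₁ c₂ f₂ : ℕ} (7≤n : 7 ≤ n)
                  (floorX : IsFloorX n f₁) (ceilY : IsCeilY n c₁)
                  (ceilX : IsCeilX n c₂) (floorY : IsFloorY n f₂) where

  1≤n : 1 ≤ n
  1≤n = ≤-trans (s≤s z≤n) 7≤n

  split₁ : f₁ + c₁ ≡ n
  split₁ = floorX+ceilY≡n 1≤n floorX ceilY

  split₂ : c₂ + f₂ ≡ n
  split₂ = ceilX+floorY≡n 1≤n ceilX floorY

  f₁≤c₁ : f₁ ≤ c₁
  f₁≤c₁ = 4*a≤2*n⇒a≤b split₁ (proj₁ (proj₁ floorX))

  c₂≤f₂ : c₂ ≤ f₂
  c₂≤f₂ = 4*a≤2*n⇒a≤b split₂ (ceilX-≤-half {c = c₂} (≤-trans (m≤m+n 3 4) 7≤n) ceilX)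

  1≤f₁ : 1 ≤ f₁
  1≤f₁ = floorX-positive 7≤n floorX

  1≤c₂ : 1 ≤ c₂
  1≤c₂ = ceilX-positive 1≤n ceilX

  f₁-below-vertex : 4 * (f₁ * c₁) ≤ ∣ f₁ - c₁ ∣²
  f₁-below-vertex = left-of-x⇒4*[a*b]≤∣a-b∣² split₁ f₁≤c₁ (proj₂ (proj₁ floorX))

  c₂-above-vertex : ∣ c₂ - f₂ ∣² ≤ 4 * (c₂ * f₂)
  c₂-above-vertex = right-of-x⇒∣a-b∣²≤4*[a*b] split₂ c₂≤f₂ (∸-≤n√2 {n} (proj₁ ceilX))

  ordered-cover : ∀ {a b} → a + b ≡ n → a ≤ b → σK a b ≤ σK f₁ c₁ ⊎ σK a b ≤ σK c₂ f₂
  ordered-cover {a} {b} a+b≡n a≤b with ≤-total (2 * (n * n)) ((2 * n ∸ 4 * a) * (2 * n ∸ 4 * a))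
  ... | inj₁ left  = inj₁ (σK-≤-below-vertex a≤f₁ f₁≤c₁ (trans a+b≡n (sym split₁)) f₁-below-vertex)
    where
    a≤f₁ : a ≤ f₁
    a≤f₁ = floorX-greatest {n} floorX (a≤b⇒4*a≤2*n a+b≡n a≤b) left
  ... | inj₂ right = inj₂ (σK-≤-above-vertex c₂≤a a≤b (trans a+b≡n (sym split₂)) c₂-above-vertex)
    where
    c₂≤a : c₂ ≤ a
    c₂≤a = ceilX-least {n} ceilX right

  cover : ∀ a b → a + b ≡ n → σK a b ≤ σK f₁ c₁ ⊎ σK a b ≤ σK c₂ f₂
  cover a b a+b≡n with ≤-total a b
  ... | inj₁ a≤b = ordered-cover a+b≡n a≤b
  ... | inj₂ b≤a rewrite σK-comm a b = ordered-cover (trans (+-comm b a) a+b≡n) b≤a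

proposition11 : (n : ℕ) → 7 ≤ n →
    (f₁ c₁ f₂ c₂ : ℕ) →
    IsFloorX n f₁ → IsCeilY n c₁ → IsCeilX n c₂ → IsFloorY n f₂ →
    MaxAmongKab n f₁ c₁ ⊎ MaxAmongKab n c₂ f₂
proposition11 n 7≤n f₁ c₁ f₂ c₂ floorX ceilY ceilX floorY =
  maxAmongKab-of-cover split₁ 1≤f₁ (≤-trans 1≤f₁ f₁≤c₁) split₂ 1≤c₂ (≤-trans 1≤c₂ c₂≤f₂) cover
  where open Candidates {n} {f₁} {c₁} {c₂} {f₂} 7≤n floorX ceilY ceilX floorY
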